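{- Let $(M,\leq,\sqsubseteq)$ be a mixed lattice. If the pre-regularity condition holds, i.e. $x\sqsubseteq y$ implies $x\leq y$ for all $x,y\in M$, then for all $x,y\in M$ we have $x\leq y \iff y\sqcup x=y \iff x\sqcap y=x$. Moreover, if these equivalences $x\leq y \iff y\sqcup x=y \iff x\sqcap y=x$ hold for all $x,y\in M$, then $x\sqcup(y\sqcap x)=x$ and $x\sqcap(y\sqcup x)=x$ for all $x,y\in M$.
   Context: Let $M$ be a set with two partial orderings $\leq$ and $\sqsubseteq$. For $x,y\in M$ the mixed upper envelope is $x\sqcup y=\min\{w\in M: x\sqsubseteq w \text{ and } y\leq w\}$ and the mixed lower envelope is $x\sqcap y=\max\{w\in M: w\sqsubseteq x\text{ and } w\leq y\}$, where the minimum and maximum are taken with respect to $\leq$. The triple $(M,\leq,\sqsubseteq)$ is called a mixed lattice if $x\sqcup y$ and $x\sqcap y$ exist in $M$ for all $x,y\in M$. -}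

module Defs where

open import Level using (Level; _⊔_; suc)
open import Data.Product using (_×_)
open import Relation.Binary.Core using (Rel)
open import Relation.Binary.Structures using (IsPartialOrder)
open import Relation.Binary.PropositionalEquality using (_≡_)
open import Function.Bundles using (_⇔_)

IsMinimum : ∀ {a ℓ p} {A : Set a} → Rel A ℓ → (A → Set p) → A → Set (a ⊔ ℓ ⊔ p)
IsMinimum _≤_ P m = P m × (∀ w → P w → m ≤ w)

IsMaximum : ∀ {a ℓ p} {A : Set a} → Rel A ℓ → (A → Set p) → A → Set (a ⊔ ℓ ⊔ p)
IsMaximum _≤_ P m = P m × (∀ w → P w → w ≤ m)

-- Since minima/maxima w.r.t. a partial order are unique, recording them as
-- operations is equivalent to requiring existence.
record MixedLattice (a ℓ₁ ℓ₂ : Level) : Set (suc (a ⊔ ℓ₁ ⊔ ℓ₂)) where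
  field
    Carrier : Set a
    _≤_ : Rel Carrier ℓ₁
    _⊑_ : Rel Carrier ℓ₂
    ≤-isPartialOrder : IsPartialOrder _≡_ _≤_
    ⊑-isPartialOrder : IsPartialOrder _≡_ _⊑_
    _⊔ₘ_ : Carrier → Carrier → Carrier
    _⊓ₘ_ : Carrier → Carrier → Carrier
    ⊔ₘ-spec : ∀ x y → IsMinimum _≤_ (λ w → (x ⊑ w) × (y ≤ w)) (x ⊔ₘ y)
    ⊓ₘ-spec : ∀ x y → IsMaximum _≤_ (λ w → (w ⊑ x) × (w ≤ y)) (x ⊓ₘ y)

module _ {a ℓ₁ ℓ₂} (L : MixedLattice a ℓ₁ ℓ₂) where
  open MixedLattice L

  PreRegular : Set (a ⊔ ℓ₁ ⊔ ℓ₂)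
  PreRegular = ∀ x y → x ⊑ y → x ≤ y

  EnvelopeCharacterisation : Set (a ⊔ ℓ₁)
  EnvelopeCharacterisation =
    ∀ x y → ((x ≤ y) ⇔ ((y ⊔ₘ x) ≡ y)) × (((y ⊔ₘ x) ≡ y) ⇔ ((x ⊓ₘ y) ≡ x))

-- Under pre-regularity the ⊑-condition in an envelope's definition already
-- forces ≤-comparability, so y ⊔ x and x ⊓ y collapse to y and x exactly
-- when x ≤ y.  Given that collapse, absorption needs only y ⊓ x ≤ x and
-- x ≤ y ⊔ x, which hold in every mixed lattice.
module Submission where

open import Defs
open import Data.Product using (_×_; _,_; proj₁; proj₂)
open import Relation.Binary.PropositionalEquality using (_≡_; subst)
open import Relation.Binary.Structures using (IsPartialOrder)
open import Function.Bundles using (mk⇔; Equivalence)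

module MixedLatticeProperties {a ℓ₁ ℓ₂} (L : MixedLattice a ℓ₁ ℓ₂) where
  open MixedLattice L
  module ≤ = IsPartialOrder ≤-isPartialOrder
  module ⊑ = IsPartialOrder ⊑-isPartialOrder

  ⊔ₘ-⊒ˡ : ∀ x y → x ⊑ (x ⊔ₘ y)
  ⊔ₘ-⊒ˡ x y = proj₁ (proj₁ (⊔ₘ-spec x y))

  ⊔ₘ-≥ʳ : ∀ x y → y ≤ (x ⊔ₘ y)
  ⊔ₘ-≥ʳ x y = proj₂ (proj₁ (⊔ₘ-spec x y))

  ⊔ₘ-least : ∀ {x y w} → x ⊑ w → y ≤ w → (x ⊔ₘ y) ≤ w
  ⊔ₘ-least {x} {y} {w} x⊑w y≤w = proj₂ (⊔ₘ-spec x y) w (x⊑w , y≤w)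

  ⊓ₘ-⊑ˡ : ∀ x y → (x ⊓ₘ y) ⊑ x
  ⊓ₘ-⊑ˡ x y = proj₁ (proj₁ (⊓ₘ-spec x y))

  ⊓ₘ-≤ʳ : ∀ x y → (x ⊓ₘ y) ≤ y
  ⊓ₘ-≤ʳ x y = proj₂ (proj₁ (⊓ₘ-spec x y))

  ⊓ₘ-greatest : ∀ {x y w} → w ⊑ x → w ≤ y → w ≤ (x ⊓ₘ y)
  ⊓ₘ-greatest {x} {y} {w} w⊑x w≤y = proj₂ (⊓ₘ-spec x y) w (w⊑x , w≤y)

  ⊔ₘ-identity⇒≤ : ∀ {x y} → (y ⊔ₘ x) ≡ y → x ≤ y
  ⊔ₘ-identity⇒≤ {x} e = subst (x ≤_) e (⊔ₘ-≥ʳ _ x)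

  ⊓ₘ-identity⇒≤ : ∀ {x y} → (x ⊓ₘ y) ≡ x → x ≤ y
  ⊓ₘ-identity⇒≤ {y = y} e = subst (_≤ y) e (⊓ₘ-≤ʳ _ y)

  module _ (preRegular : PreRegular L) where

    ≤⇒⊔ₘ-identity : ∀ {x y} → x ≤ y → (y ⊔ₘ x) ≡ y
    ≤⇒⊔ₘ-identity {x} {y} x≤y =
      ≤.antisym (⊔ₘ-least ⊑.refl x≤y) (preRegular _ _ (⊔ₘ-⊒ˡ y x))

    ≤⇒⊓ₘ-identity : ∀ {x y} → x ≤ y → (x ⊓ₘ y) ≡ x
    ≤⇒⊓ₘ-identity {x} {y} x≤y =
      ≤.antisym (preRegular _ _ (⊓ₘ-⊑ˡ x y)) (⊓ₘ-greatest ⊑.refl x≤y)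

    preRegular⇒envelopeCharacterisation : EnvelopeCharacterisation L
    preRegular⇒envelopeCharacterisation x y =
        mk⇔ ≤⇒⊔ₘ-identity ⊔ₘ-identity⇒≤
      , mk⇔ (λ e → ≤⇒⊓ₘ-identity (⊔ₘ-identity⇒≤ e))
            (λ e → ≤⇒⊔ₘ-identity (⊓ₘ-identity⇒≤ e))

  module _ (characterisation : EnvelopeCharacterisation L) where

    characterisation-≤⇒⊔ₘ : ∀ {x y} → x ≤ y → (y ⊔ₘ x) ≡ y
    characterisation-≤⇒⊔ₘ {x} {y} = Equivalence.to (proj₁ (characterisation x y))

    characterisation-≤⇒⊓ₘ : ∀ {x y} → x ≤ y → (x ⊓ₘ y) ≡ x
    characterisation-≤⇒⊓ₘ {x} {y} x≤y =
      Equivalence.to (proj₂ (characterisation x y)) (characterisation-≤⇒⊔ₘ x≤y)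

    ⊔ₘ-absorbs-⊓ₘ : ∀ x y → (x ⊔ₘ (y ⊓ₘ x)) ≡ x
    ⊔ₘ-absorbs-⊓ₘ x y = characterisation-≤⇒⊔ₘ (⊓ₘ-≤ʳ y x)

    ⊓ₘ-absorbs-⊔ₘ : ∀ x y → (x ⊓ₘ (y ⊔ₘ x)) ≡ x
    ⊓ₘ-absorbs-⊔ₘ x y = characterisation-≤⇒⊓ₘ (⊔ₘ-≥ʳ y x)

theorem2p5 : ∀ {a ℓ₁ ℓ₂} (L : MixedLattice a ℓ₁ ℓ₂) →
    (PreRegular L → EnvelopeCharacterisation L)
    × (EnvelopeCharacterisation L →
        ∀ x y → (MixedLattice._⊔ₘ_ L x (MixedLattice._⊓ₘ_ L y x) ≡ x)
              × (MixedLattice._⊓ₘ_ L x (MixedLattice._⊔ₘ_ L y x) ≡ x))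
theorem2p5 L =
    preRegular⇒envelopeCharacterisation
  , λ characterisation x y →
      ⊔ₘ-absorbs-⊓ₘ characterisation x y , ⊓ₘ-absorbs-⊔ₘ characterisation x y
  where open MixedLatticeProperties L
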